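{- Fix $d\ge3$. The minimum degree of $\mathcal{D}_{d-1}(\mathbb{Q}^d)$ is at least $2^{d}/d^4$, and each connected component of $\mathcal{D}_{d-1}(\mathbb{Q}^d)$ contains at least $2^{2^{d}/d^4}$ dimer configurations.
   Context: $\mathbb{Q}^d$ is the unit hypercube graph with vertex set $\{1,2\}^d$, two vertices adjacent iff they differ in exactly one coordinate. A dimer configuration on a graph $G$ is a perfect matching; its edges are dimers. An alternating cycle is a cycle of even length in which every second edge is a dimer; switching it exchanges dimer and non-dimer edges along the cycle. For $\ell\ge 2$, $\mathcal{D}_\ell(G)$ is the graph on dimer configurations of $G$ in which two configurations are adjacent if one is obtained from the other by switching an alternating cycle of length at most $2\ell$. -}

module Defs where

open import Data.Nat using (ℕ; zero; suc; _≤_; _*_; _^_; _∸_)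
open import Data.Nat.DivMod using (_mod_)
open import Data.Bool using (Bool; not)
open import Data.Fin using (Fin; toℕ)
open import Data.Vec using (Vec; updateAt)
open import Data.Product using (Σ; ∃; ∃-syntax; _×_; _,_)
open import Data.Sum using (_⊎_)
open import Relation.Nullary using (¬_)
open import Relation.Binary.PropositionalEquality using (_≡_; _≢_)
open import Relation.Binary.Construct.Closure.ReflexiveTransitive using (Star)

-- Vertices of the hypercube Q^d: words in {1,2}^d, encoded as Vec Bool d.
Vertex : ℕ → Set
Vertex d = Vec Bool d

flipAt : ∀ {d} → Vertex d → Fin d → Vertex d
flipAt v i = updateAt v i not

Adj : ∀ {d} → Vertex d → Vertex d → Set
Adj {d} u v = Σ (Fin d) λ i → v ≡ flipAt u i

-- A dimer configuration (perfect matching) of Q^d, given by the direction of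
-- the unique dimer at each vertex; the partner of v is flipAt v (dir v),
-- and consistency says the partner's dimer is the same edge.
record Dimer (d : ℕ) : Set where
  field
    dir        : Vertex d → Fin d
    consistent : ∀ v → dir (flipAt v (dir v)) ≡ dir v
open Dimer public

partner : ∀ {d} → Dimer d → Vertex d → Vertex d
partner M v = flipAt v (dir M v)

IsDimer : ∀ {d} → Dimer d → Vertex d → Vertex d → Set
IsDimer M u v = v ≡ partner M u

sucMod : ∀ {n} → Fin (suc n) → Fin (suc n)
sucMod {n} i = suc (toℕ i) mod suc n

-- An alternating cycle of length 2(n+1) (with n ≥ 1, i.e. length ≥ 4) for M:
-- vertices a₀ b₀ a₁ b₁ … a_n b_n (cyclically), all distinct,
-- a_i b_i dimers of M, b_i a_{i+1 mod n+1} non-dimer edges of Q^d.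
record AltCycle {d : ℕ} (M : Dimer d) (n : ℕ) : Set where
  field
    a      : Fin (suc n) → Vertex d
    b      : Fin (suc n) → Vertex d
    a-inj  : ∀ i j → i ≢ j → a i ≢ a j
    b-inj  : ∀ i j → i ≢ j → b i ≢ b j
    ab-dis : ∀ i j → a i ≢ b j
    dimer  : ∀ i → IsDimer M (a i) (b i)
    edge   : ∀ i → Adj (b i) (a (sucMod i))
    nondim : ∀ i → ¬ IsDimer M (b i) (a (sucMod i))

OnCycle : ∀ {d n} {M : Dimer d} → AltCycle M n → Vertex d → Set
OnCycle C v = (∃[ i ] v ≡ AltCycle.a C i) ⊎ (∃[ i ] v ≡ AltCycle.b C i)

SwitchedBy : ∀ {d n} (M : Dimer d) → AltCycle M n → Dimer d → Set
SwitchedBy {d} {n} M C M' =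
    (∀ i → IsDimer M' (AltCycle.b C i) (AltCycle.a C (sucMod i)))
  × (∀ i → IsDimer M' (AltCycle.a C (sucMod i)) (AltCycle.b C i))
  × (∀ v → ¬ OnCycle C v → dir M' v ≡ dir M v)

-- M' is obtained from M by switching an alternating cycle of length ≤ 2ℓ
-- (cycle length 2(n+1) with 1 ≤ n and n+1 ≤ ℓ)
SwitchStep : ∀ {d} → ℕ → Dimer d → Dimer d → Set
SwitchStep ℓ M M' = ∃[ n ] (1 ≤ n × suc n ≤ ℓ × Σ (AltCycle M n) λ C → SwitchedBy M C M')

DAdj : ∀ {d} → ℕ → Dimer d → Dimer d → Set
DAdj ℓ M M' = SwitchStep ℓ M M' ⊎ SwitchStep ℓ M' M

Different : ∀ {d} → Dimer d → Dimer d → Set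
Different M N = ∃[ v ] dir M v ≢ dir N v

PairwiseDifferent : ∀ {d k} → (Fin k → Dimer d) → Set
PairwiseDifferent f = ∀ i j → i ≢ j → Different (f i) (f j)

Connected : ∀ {d} → ℕ → Dimer d → Dimer d → Set
Connected ℓ = Star (DAdj ℓ)

{-# OPTIONS --safe #-}

-- Around every vertex v there is an alternating cycle of length at most 2(d − 1) whose vertices
-- all lie within distance 2 of v. Let i be the direction of the dimer at v. Either the dimers at
-- v and at some neighbour v + eⱼ span a square, or j ↦ (direction of the dimer at v + eⱼ) maps the
-- d − 1 directions other than i into themselves without fixed points; it then has a periodic orbit
-- of length between 2 and d − 1, and the dimers at v + eⱼ for j on that orbit close up into an
-- alternating cycle. A maximal family of pairwise vertex-disjoint such cycles comes within
-- distance 2 of every vertex, so it has K ≥ 2^d / (2d(1 + d + d²)) ≥ 2^d / d⁴ members. Switching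
-- any one of them gives K distinct neighbours of M in D_{d−1}; switching any subset of them, one
-- cycle at a time, gives 2^K distinct configurations in the component of M.

module Submission where

open import Defs
open import Data.Bool using (Bool; true; false; not; _xor_)
import Data.Bool.Properties as Bool
open import Data.Bool.Properties using (not-involutive; not-¬; not-distribˡ-xor; not-distribʳ-xor)
open import Data.Fin using (Fin; zero; suc; toℕ; fromℕ; fromℕ<; inject₁; punchOut; finToFun; funToFin; combine)
import Data.Fin.Properties as Fin
open import Data.List using (List; []; _∷_; _++_; length; map; foldr; concatMap; tabulate; allFin; lookup)
open import Data.List.Properties using (length-++; length-tabulate)
open import Data.List.Membership.Propositional using (_∈_; find; lose)
open import Data.List.Membership.Propositional.Properties
  using (∈-++⁺ˡ; ∈-++⁺ʳ; ∈-++⁻; ∈-map⁺; ∈-tabulate⁺; ∈-tabulate⁻; ∈-concat⁺′; ∈-lookup)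
open import Data.List.Relation.Unary.All as All using (All; []; _∷_)
open import Data.List.Relation.Unary.All.Properties.Core using (¬Any⇒All¬)
open import Data.List.Relation.Unary.AllPairs using (AllPairs; []; _∷_)
open import Data.List.Relation.Unary.Any as Any using (Any; here; there; any?)
open import Data.List.Relation.Unary.Any.Properties using (lookup-index)
open import Data.Nat using (ℕ; zero; suc; _+_; _*_; _^_; _∸_; _<_; _≤_; z≤n; s≤s)
open import Data.Nat.DivMod using (_%_; n%n≡0; m<n⇒m%n≡m; m%n<n)
open import Data.Nat.Induction using (<-rec)
import Data.Nat.Properties as ℕ
open import Data.Nat.Tactic.RingSolver using (solve-∀)
open import Data.Product using (Σ; ∃; ∃₂; ∃-syntax; _×_; _,_; proj₁; proj₂)
open import Data.Sum using (_⊎_; inj₁; inj₂)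
open import Data.Vec using ([]; _∷_)
import Data.Vec as Vec
open import Data.Vec.Properties
  using (updateAt-updateAt-local; updateAt-id; updateAt-commutes; lookup∘updateAt; lookup∘updateAt′; lookup∘tabulate; ≡-dec)
open import Function using (_∘_; Inverse)
open import Relation.Binary using (Decidable; DecidableEquality; Symmetric; tri<; tri≈; tri>)
open import Relation.Binary.Construct.Closure.ReflexiveTransitive using (ε; _◅_; _◅◅_)
open import Relation.Binary.PropositionalEquality
open import Relation.Nullary using (¬_; Dec; yes; no; does; contradiction; ¬?)
open import Relation.Nullary.Decidable using (_×-dec_; _⊎-dec_; dec-true; dec-false; map′)
import Relation.Unary as U

LeastWitness : (ℕ → Set) → ℕ → Set
LeastWitness P m = ∃ λ q → q ≤ m × P q × (∀ {s} → s < q → ¬ P s)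

least-witness : ∀ {P : ℕ → Set} → U.Decidable P → ∀ {m} → P m → LeastWitness P m
least-witness {P} P? {m} = <-rec (λ m → P m → LeastWitness P m) search m
  where
  search : ∀ m → (∀ {s} → s < m → P s → LeastWitness P s) → P m → LeastWitness P m
  search m smaller Pm with ℕ.anyUpTo? P? m
  ... | yes (s , s<m , Ps) =
    let q , q≤s , Pq , least = smaller s<m Ps in q , ℕ.≤-trans q≤s (ℕ.<⇒≤ s<m) , Pq , least
  ... | no none = m , ℕ.≤-refl , Pm , λ s<m Ps → none (_ , s<m , Ps)

module _ {m} (g : ℕ → Fin m) where

  Repeats : ℕ → Set
  Repeats q = ∃ λ p → p < q × g p ≡ g q

  repeats? : U.Decidable Repeats
  repeats? q = ℕ.anyUpTo? (λ p → g p Fin.≟ g q) q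

  firstRepetition :
    ∃₂ λ p n → suc (p + n) ≤ m × g (suc (p + n)) ≡ g p × (∀ {r s} → r < s → s ≤ p + n → g r ≢ g s)
  firstRepetition with Fin.pigeonhole (ℕ.n<1+n m) (g ∘ toℕ)
  ... | t₁ , t₂ , t₁<t₂ , gt₁≡gt₂ with least-witness repeats? (toℕ t₁ , t₁<t₂ , gt₁≡gt₂)
  ...   | q , q≤t₂ , (p , p<q , gp≡gq) , least with q ∸ suc p | ℕ.m+[n∸m]≡n p<q
  ...     | n | refl = p , n , ℕ.≤-trans q≤t₂ (ℕ.≤-pred (Fin.toℕ<n t₂)) , sym gp≡gq
                     , λ r<s s≤p+n eq → least (s≤s s≤p+n) (_ , r<s , eq)

module Greedy {A : Set} {_~_ : A → A → Set} (_~?_ : Decidable _~_) (~-refl : ∀ {x} → x ~ x) where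

  insert : A → List A → List A
  insert x ys with any? (x ~?_) ys
  ... | yes _ = ys
  ... | no _ = x ∷ ys

  greedy : List A → List A
  greedy = foldr insert []

  greedy-independent : ∀ xs → AllPairs (λ x y → ¬ x ~ y) (greedy xs)
  greedy-independent [] = []
  greedy-independent (x ∷ xs) with any? (x ~?_) (greedy xs)
  ... | yes _ = greedy-independent xs
  ... | no none = ¬Any⇒All¬ _ none ∷ greedy-independent xs

  insert-dominates : ∀ x ys → Any (x ~_) (insert x ys)
  insert-dominates x ys with any? (x ~?_) ys
  ... | yes some = some
  ... | no _ = here ~-refl

  insert-preserves : ∀ {z} x ys → Any (z ~_) ys → Any (z ~_) (insert x ys)
  insert-preserves x ys some with any? (x ~?_) ys
  ... | yes _ = some
  ... | no _ = there some

  greedy-maximal : ∀ {x xs} → x ∈ xs → Any (x ~_) (greedy xs)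
  greedy-maximal {xs = x ∷ xs} (here refl) = insert-dominates x (greedy xs)
  greedy-maximal {xs = y ∷ xs} (there x∈xs) = insert-preserves y (greedy xs) (greedy-maximal x∈xs)

AllPairs-lookup : ∀ {A : Set} {R : A → A → Set} → Symmetric R → ∀ {xs} → AllPairs R xs →
  ∀ i j → i ≢ j → R (lookup xs i) (lookup xs j)
AllPairs-lookup R-sym (_ ∷ _) zero zero 0≢0 = contradiction refl 0≢0
AllPairs-lookup R-sym (Rx ∷ _) zero (suc j) _ = All.lookup Rx (∈-lookup j)
AllPairs-lookup R-sym (Rx ∷ _) (suc i) zero _ = R-sym (All.lookup Rx (∈-lookup i))
AllPairs-lookup R-sym (_ ∷ Rxs) (suc i) (suc j) i≢j = AllPairs-lookup R-sym Rxs i j (i≢j ∘ cong suc)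

length-concatMap-≤ : ∀ {A B : Set} (f : A → List B) {k} → (∀ x → length (f x) ≤ k) →
  ∀ xs → length (concatMap f xs) ≤ length xs * k
length-concatMap-≤ f bound [] = z≤n
length-concatMap-≤ f bound (x ∷ xs) =
  ℕ.≤-trans (ℕ.≤-reflexive (length-++ (f x))) (ℕ.+-mono-≤ (bound x) (length-concatMap-≤ f bound xs))

bits : ∀ K → Fin (2 ^ K) → Fin K → Bool
bits K x = Inverse.to Fin.2↔Bool ∘ finToFun {2} {K} x

funToFin-cong : ∀ {m n} {f g : Fin m → Fin n} → (∀ k → f k ≡ g k) → funToFin f ≡ funToFin g
funToFin-cong {zero} eq = refl
funToFin-cong {suc m} eq = cong₂ combine (eq zero) (funToFin-cong (eq ∘ suc))

bits-injective : ∀ {K} {x y : Fin (2 ^ K)} → (∀ k → bits K x k ≡ bits K y k) → x ≡ y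
bits-injective {K} {x} {y} eq = begin
  x                               ≡⟨ Fin.funToFin-finToFin {K} {2} x ⟨
  funToFin (finToFun {2} {K} x)   ≡⟨ funToFin-cong (λ k → fin2-injective (eq k)) ⟩
  funToFin (finToFun {2} {K} y)   ≡⟨ Fin.funToFin-finToFin {K} {2} y ⟩
  y                               ∎
  where
  open ≡-Reasoning
  open Inverse Fin.2↔Bool using (to; from; strictlyInverseʳ)
  fin2-injective : ∀ {s t} → to s ≡ to t → s ≡ t
  fin2-injective {s} {t} eq = trans (sym (strictlyInverseʳ s)) (trans (cong from eq) (strictlyInverseʳ t))

bits-distinguish : ∀ {K} {x y : Fin (2 ^ K)} → x ≢ y → ∃ λ k → bits K x k ≢ bits K y k
bits-distinguish {K} {x} {y} x≢y =
  Fin.¬∀⟶∃¬ K _ (λ k → bits K x k Bool.≟ bits K y k) (x≢y ∘ bits-injective)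

flipAt-involutive : ∀ {d} (v : Vertex d) i → flipAt (flipAt v i) i ≡ v
flipAt-involutive v i = trans (updateAt-updateAt-local i v (not-involutive _)) (updateAt-id i v)

flipAt-comm : ∀ {d} (v : Vertex d) i j → flipAt (flipAt v i) j ≡ flipAt (flipAt v j) i
flipAt-comm v i j with i Fin.≟ j
... | yes refl = refl
... | no i≢j = updateAt-commutes j i (i≢j ∘ sym) v

lookup-flipAt : ∀ {d} (v : Vertex d) i → Vec.lookup (flipAt v i) i ≡ not (Vec.lookup v i)
lookup-flipAt v i = lookup∘updateAt i v

flipAt-irreflexive : ∀ {d} (v : Vertex d) i → flipAt v i ≢ v
flipAt-irreflexive v i eq = not-¬ refl (sym (trans (sym (lookup-flipAt v i)) (cong (λ w → Vec.lookup w i) eq)))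

flipAt-injectiveʳ : ∀ {d} (v : Vertex d) {i j} → flipAt v i ≡ flipAt v j → i ≡ j
flipAt-injectiveʳ v {i} {j} eq with i Fin.≟ j
... | yes i≡j = i≡j
... | no i≢j = contradiction
  (trans (sym (lookup-flipAt v i)) (trans (cong (λ w → Vec.lookup w i) eq) (lookup∘updateAt′ i j i≢j v)))
  (not-¬ refl ∘ sym)

parity : ∀ {d} → Vertex d → Bool
parity [] = false
parity (x ∷ v) = x xor parity v

parity-flipAt : ∀ {d} (v : Vertex d) i → parity (flipAt v i) ≡ not (parity v)
parity-flipAt (x ∷ v) zero = sym (not-distribˡ-xor x (parity v))
parity-flipAt (x ∷ v) (suc i) = trans (cong (x xor_) (parity-flipAt v i)) (sym (not-distribʳ-xor x (parity v)))

flipAt≢flipAt² : ∀ {d} (v : Vertex d) i j k → flipAt v i ≢ flipAt (flipAt v j) k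
flipAt≢flipAt² v i j k eq = not-¬ refl (begin
  parity v                        ≡⟨ not-involutive (parity v) ⟨
  not (not (parity v))            ≡⟨ cong not (parity-flipAt v j) ⟨
  not (parity (flipAt v j))       ≡⟨ parity-flipAt (flipAt v j) k ⟨
  parity (flipAt (flipAt v j) k)  ≡⟨ cong parity eq ⟨
  parity (flipAt v i)             ≡⟨ parity-flipAt v i ⟩
  not (parity v)                  ∎)
  where open ≡-Reasoning

flipAt²≢ : ∀ {d} (v : Vertex d) {i j} → i ≢ j → flipAt (flipAt v i) j ≢ v
flipAt²≢ v {i} {j} i≢j eq =
  i≢j (flipAt-injectiveʳ v (trans (sym (flipAt-involutive (flipAt v i) j)) (cong (λ w → flipAt w j) eq)))

_≟ᵛ_ : ∀ {d} → DecidableEquality (Vertex d)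
_≟ᵛ_ = ≡-dec Bool._≟_

Near : ∀ {d} → Vertex d → Vertex d → Set
Near v w = w ≡ v ⊎ (∃[ j ] w ≡ flipAt v j) ⊎ (∃₂ λ j l → w ≡ flipAt (flipAt v j) l)

allVertices : ∀ d → List (Vertex d)
allVertices zero = [] ∷ []
allVertices (suc d) = map (true ∷_) (allVertices d) ++ map (false ∷_) (allVertices d)

∈-allVertices : ∀ {d} (v : Vertex d) → v ∈ allVertices d
∈-allVertices [] = here refl
∈-allVertices (true ∷ v) = ∈-++⁺ˡ (∈-map⁺ (true ∷_) (∈-allVertices v))
∈-allVertices {suc d} (false ∷ v) =
  ∈-++⁺ʳ (map (true ∷_) (allVertices d)) (∈-map⁺ (false ∷_) (∈-allVertices v))

2^d≤length : ∀ {d} {L : List (Vertex d)} → (∀ v → v ∈ L) → 2 ^ d ≤ length L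
2^d≤length {d} {L} covers = Fin.injective⇒≤ position-injective
  where
  vertex : Fin (2 ^ d) → Vertex d
  vertex x = Vec.tabulate (bits d x)
  position : Fin (2 ^ d) → Fin (length L)
  position x = Any.index (covers (vertex x))
  position-injective : ∀ {x y} → position x ≡ position y → x ≡ y
  position-injective {x} {y} eq = bits-injective λ k → begin
    bits d x k                ≡⟨ lookup∘tabulate (bits d x) k ⟨
    Vec.lookup (vertex x) k   ≡⟨ cong (λ w → Vec.lookup w k) same-vertex ⟩
    Vec.lookup (vertex y) k   ≡⟨ lookup∘tabulate (bits d y) k ⟩
    bits d y k                ∎
    where
    open ≡-Reasoning
    same-vertex : vertex x ≡ vertex y
    same-vertex = trans (lookup-index (covers (vertex x)))
      (trans (cong (lookup L) eq) (sym (lookup-index (covers (vertex y)))))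

ball₂ : ∀ {d} → Vertex d → List (Vertex d)
ball₂ {d} w = w ∷ tabulate (flipAt w) ++ concatMap (λ j → tabulate (flipAt (flipAt w j))) (allFin d)

length-ball₂ : ∀ {d} (w : Vertex d) → length (ball₂ w) ≤ suc (d + d * d)
length-ball₂ {d} w = s≤s (ℕ.≤-trans (ℕ.≤-reflexive (length-++ (tabulate (flipAt w))))
  (ℕ.+-mono-≤ (ℕ.≤-reflexive (length-tabulate (flipAt w)))
    (ℕ.≤-trans (length-concatMap-≤ _ (λ j → ℕ.≤-reflexive (length-tabulate _)) (allFin d))
      (ℕ.≤-reflexive (cong (_* d) (length-tabulate {n = d} (λ j → j)))))))

near-∈-ball₂ : ∀ {d} {u w : Vertex d} → Near u w → u ∈ ball₂ w
near-∈-ball₂ (inj₁ refl) = here refl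
near-∈-ball₂ {u = u} (inj₂ (inj₁ (j , refl))) =
  there (∈-++⁺ˡ (subst (_∈ tabulate (flipAt (flipAt u j))) (flipAt-involutive u j) (∈-tabulate⁺ j)))
near-∈-ball₂ {u = u} (inj₂ (inj₂ (j , l , refl))) =
  there (∈-++⁺ʳ (tabulate (flipAt w)) (∈-concat⁺′ u∈ (∈-map⁺ _ (∈-tabulate⁺ l))))
  where
  w = flipAt (flipAt u j) l
  u∈ : u ∈ tabulate (flipAt (flipAt w l))
  u∈ = subst (_∈ tabulate (flipAt (flipAt w l))) back (∈-tabulate⁺ j)
    where
    back : flipAt (flipAt w l) j ≡ u
    back = trans (cong (λ z → flipAt z j) (flipAt-involutive (flipAt u j) l)) (flipAt-involutive u j)

2d[1+d+d²]≤d⁴ : ∀ {d} → 3 ≤ d → (d + d) * suc (d + d * d) ≤ d ^ 4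
2d[1+d+d²]≤d⁴ {suc (suc (suc e))} (s≤s (s≤s (s≤s _))) =
  ℕ.≤-trans (ℕ.m≤m+n _ _) (ℕ.≤-reflexive (sym (expand e)))
  where
  expand : ∀ e → (3 + e) * ((3 + e) * ((3 + e) * ((3 + e) * 1)))
               ≡ ((3 + e) + (3 + e)) * suc ((3 + e) + (3 + e) * (3 + e))
                 + (3 + 40 * e + 34 * (e * e) + 10 * (e * e * e) + e * e * e * e)
  expand = solve-∀

partner-involutive : ∀ {d} (M : Dimer d) v → partner M (partner M v) ≡ v
partner-involutive M v = trans (cong (flipAt (partner M v)) (consistent M v)) (flipAt-involutive v (dir M v))

partner-injective : ∀ {d} (M : Dimer d) {u v} → partner M u ≡ partner M v → u ≡ v
partner-injective M {u} {v} eq = trans (sym (partner-involutive M u)) (trans (cong (partner M) eq) (partner-involutive M v))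

toℕ-sucMod : ∀ {n} (i : Fin (suc n)) → toℕ (sucMod i) ≡ suc (toℕ i) % suc n
toℕ-sucMod {n} i = Fin.toℕ-fromℕ< (m%n<n (suc (toℕ i)) (suc n))

toℕ-sucMod-< : ∀ {n} (i : Fin (suc n)) → toℕ i < n → toℕ (sucMod i) ≡ suc (toℕ i)
toℕ-sucMod-< i i<n = trans (toℕ-sucMod i) (m<n⇒m%n≡m (s≤s i<n))

toℕ-sucMod-last : ∀ {n} (i : Fin (suc n)) → toℕ i ≡ n → toℕ (sucMod i) ≡ 0
toℕ-sucMod-last {n} i i≡n = trans (toℕ-sucMod i) (trans (cong (λ m → suc m % suc n) i≡n) (n%n≡0 (suc n)))

<-or-last : ∀ {n} (i : Fin (suc n)) → toℕ i < n ⊎ toℕ i ≡ n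
<-or-last i = ℕ.m≤n⇒m<n∨m≡n (Fin.toℕ≤pred[n] i)

sucMod-injective : ∀ {n} {i j : Fin (suc n)} → sucMod i ≡ sucMod j → i ≡ j
sucMod-injective {i = i} {j} eq with <-or-last i | <-or-last j
... | inj₁ i<n | inj₁ j<n = Fin.toℕ-injective (ℕ.suc-injective
  (trans (sym (toℕ-sucMod-< i i<n)) (trans (cong toℕ eq) (toℕ-sucMod-< j j<n))))
... | inj₁ i<n | inj₂ j≡n = contradiction
  (trans (sym (toℕ-sucMod-last j j≡n)) (trans (cong toℕ (sym eq)) (toℕ-sucMod-< i i<n))) ℕ.0≢1+n
... | inj₂ i≡n | inj₁ j<n = contradiction
  (trans (sym (toℕ-sucMod-last i i≡n)) (trans (cong toℕ eq) (toℕ-sucMod-< j j<n))) ℕ.0≢1+n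
... | inj₂ i≡n | inj₂ j≡n = Fin.toℕ-injective (trans i≡n (sym j≡n))

sucMod-surjective : ∀ {n} (j : Fin (suc n)) → ∃[ i ] sucMod i ≡ j
sucMod-surjective {n} zero = fromℕ n , Fin.toℕ-injective (toℕ-sucMod-last _ (Fin.toℕ-fromℕ n))
sucMod-surjective {suc n} (suc j) = inject₁ j , Fin.toℕ-injective (trans
  (toℕ-sucMod-< _ (subst (_< suc n) (sym (Fin.toℕ-inject₁ j)) (Fin.toℕ<n j)))
  (cong suc (Fin.toℕ-inject₁ j)))

sucMod-≢ : ∀ {n} → 1 ≤ n → (i : Fin (suc n)) → sucMod i ≢ i
sucMod-≢ 1≤n i eq with <-or-last i
... | inj₁ i<n = ℕ.1+n≢n (trans (sym (toℕ-sucMod-< i i<n)) (cong toℕ eq))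
... | inj₂ i≡n = ℕ.<⇒≢ 1≤n (trans (trans (sym (toℕ-sucMod-last i i≡n)) (cong toℕ eq)) i≡n)

-- Switching an alternating cycle

module Switching {d n} {M : Dimer d} (C : AltCycle M n) where
  open AltCycle C

  direction : Fin (suc n) → Fin d
  direction i = proj₁ (edge i)

  next-a : ∀ i → a (sucMod i) ≡ flipAt (b i) (direction i)
  next-a i = proj₂ (edge i)

  previous-b : ∀ i → flipAt (a (sucMod i)) (direction i) ≡ b i
  previous-b i = trans (cong (λ w → flipAt w (direction i)) (next-a i)) (flipAt-involutive (b i) (direction i))

  partner-b : ∀ i → partner M (b i) ≡ a i
  partner-b i = trans (cong (partner M) (dimer i)) (partner-involutive M (a i))

  onCycle-partner : ∀ {v} → OnCycle C (partner M v) → OnCycle C v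
  onCycle-partner {v} (inj₁ (j , eq)) =
    inj₂ (j , trans (sym (partner-involutive M v)) (trans (cong (partner M) eq) (sym (dimer j))))
  onCycle-partner {v} (inj₂ (j , eq)) =
    inj₁ (j , trans (sym (partner-involutive M v)) (trans (cong (partner M) eq) (partner-b j)))

  -- v is an endpoint of the i-th dimer of the switched configuration
  Incident : Fin (suc n) → Vertex d → Set
  Incident i v = v ≡ b i ⊎ v ≡ a (sucMod i)

  incident? : ∀ v → Dec (∃[ i ] Incident i v)
  incident? v = Fin.any? λ i → (v ≟ᵛ b i) ⊎-dec (v ≟ᵛ a (sucMod i))

  incident-unique : ∀ {i j v} → Incident i v → Incident j v → i ≡ j
  incident-unique {i} {j} (inj₁ refl) (inj₁ eq) with i Fin.≟ j
  ... | yes i≡j = i≡j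
  ... | no i≢j = contradiction eq (b-inj i j i≢j)
  incident-unique (inj₁ refl) (inj₂ eq) = contradiction (sym eq) (ab-dis _ _)
  incident-unique (inj₂ refl) (inj₁ eq) = contradiction eq (ab-dis _ _)
  incident-unique {i} {j} (inj₂ refl) (inj₂ eq) with sucMod i Fin.≟ sucMod j
  ... | yes si≡sj = sucMod-injective si≡sj
  ... | no si≢sj = contradiction eq (a-inj _ _ si≢sj)

  incident⇒onCycle : ∀ {i v} → Incident i v → OnCycle C v
  incident⇒onCycle (inj₁ eq) = inj₂ (_ , eq)
  incident⇒onCycle (inj₂ eq) = inj₁ (_ , eq)

  onCycle⇒incident : ∀ {v} → OnCycle C v → ∃[ i ] Incident i v
  onCycle⇒incident {v} (inj₁ (j , eq)) with sucMod-surjective j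
  ... | i , refl = i , inj₂ eq
  onCycle⇒incident (inj₂ (j , eq)) = j , inj₁ eq

  incident-flipAt : ∀ {i v} → Incident i v → Incident i (flipAt v (direction i))
  incident-flipAt {i} (inj₁ refl) = inj₂ (sym (next-a i))
  incident-flipAt {i} (inj₂ refl) = inj₁ (previous-b i)

  switchedDir : Vertex d → Fin d
  switchedDir v with incident? v
  ... | yes (i , _) = direction i
  ... | no _ = dir M v

  switchedDir-incident : ∀ {i v} → Incident i v → switchedDir v ≡ direction i
  switchedDir-incident {i} {v} inc with incident? v
  ... | yes (j , inc′) = cong direction (incident-unique inc′ inc)
  ... | no none = contradiction (i , inc) none

  switchedDir-off : ∀ {v} → ¬ OnCycle C v → switchedDir v ≡ dir M v
  switchedDir-off {v} off with incident? v
  ... | yes (_ , inc) = contradiction (incident⇒onCycle inc) off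
  ... | no _ = refl

  switchedDir-consistent : ∀ v → switchedDir (flipAt v (switchedDir v)) ≡ switchedDir v
  switchedDir-consistent v with incident? v
  ... | yes (_ , inc) = switchedDir-incident (incident-flipAt inc)
  ... | no none = trans (switchedDir-off (none ∘ onCycle⇒incident ∘ onCycle-partner)) (consistent M v)

  switch : Dimer d
  switch = record { dir = switchedDir ; consistent = switchedDir-consistent }

  switch-switchedBy : SwitchedBy M C switch
  switch-switchedBy =
      (λ i → trans (next-a i) (cong (flipAt (b i)) (sym (switchedDir-incident (inj₁ refl)))))
    , (λ i → trans (sym (previous-b i)) (cong (flipAt (a (sucMod i))) (sym (switchedDir-incident (inj₂ refl)))))
    , λ v → switchedDir-off

  switch-changes : ∀ i → dir switch (b i) ≢ dir M (b i)
  switch-changes i eq =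
    nondim i (trans (next-a i) (cong (flipAt (b i)) (trans (sym (switchedDir-incident (inj₁ refl))) eq)))

AgreeOn : ∀ {d n} {M : Dimer d} → AltCycle M n → Dimer d → Set
AgreeOn {M = M} C N = ∀ v → OnCycle C v → dir N v ≡ dir M v

transferCycle : ∀ {d n} {M N : Dimer d} (C : AltCycle M n) → AgreeOn C N → AltCycle N n
transferCycle {M = M} {N} C agree = record
  { a = a ; b = b ; a-inj = a-inj ; b-inj = b-inj ; ab-dis = ab-dis ; edge = edge
  ; dimer = λ i → trans (dimer i) (cong (flipAt (a i)) (sym (agree (a i) (inj₁ (i , refl)))))
  ; nondim = λ i eq → nondim i (trans eq (cong (flipAt (b i)) (agree (b i) (inj₂ (i , refl)))))
  }
  where open AltCycle C

-- Short alternating cycles near every vertex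

record ShortCycle {d} (M : Dimer d) (ℓ : ℕ) : Set where
  field
    n     : ℕ
    1≤n   : 1 ≤ n
    1+n≤ℓ : suc n ≤ ℓ
    cycle : AltCycle M n

LocalCycle : ∀ {d} → Dimer d → ℕ → Vertex d → Set
LocalCycle M ℓ v = Σ (ShortCycle M ℓ) λ c → ∀ w → OnCycle (ShortCycle.cycle c) w → Near v w

near-onCycle : ∀ {d n} {M : Dimer d} {v} (C : AltCycle M n) →
  (∀ t → Near v (AltCycle.a C t)) → (∀ t → Near v (AltCycle.b C t)) → ∀ w → OnCycle C w → Near v w
near-onCycle C near-a near-b w (inj₁ (t , refl)) = near-a t
near-onCycle C near-a near-b w (inj₂ (t , refl)) = near-b t

Fin2-injective : ∀ {A : Set} (g : Fin 2 → A) → g zero ≢ g (suc zero) → ∀ s t → s ≢ t → g s ≢ g t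
Fin2-injective g g0≢g1 zero zero 0≢0 = contradiction refl 0≢0
Fin2-injective g g0≢g1 zero (suc zero) _ = g0≢g1
Fin2-injective g g0≢g1 (suc zero) zero _ = g0≢g1 ∘ sym
Fin2-injective g g0≢g1 (suc zero) (suc zero) 1≢1 = contradiction refl 1≢1

module Local {d} (M : Dimer (suc d)) (v : Vertex (suc d)) where

  i : Fin (suc d)
  i = dir M v

  f : Fin (suc d) → Fin (suc d)
  f j = dir M (flipAt v j)

  f-no-fixed-point : ∀ {j} → j ≢ i → f j ≢ j
  f-no-fixed-point {j} j≢i fj≡j = j≢i (sym (flipAt-injectiveʳ v
    (trans (cong (partner M) (sym partner-flip)) (partner-involutive M (flipAt v j)))))
    where
    partner-flip : partner M (flipAt v j) ≡ v
    partner-flip = trans (cong (flipAt (flipAt v j)) fj≡j) (flipAt-involutive v j)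

  module Square {j} (j≢i : j ≢ i) (fj≡i : f j ≡ i) where
    a b : Fin 2 → Vertex (suc d)
    a zero = v
    a (suc zero) = flipAt (flipAt v i) j
    b zero = flipAt v i
    b (suc zero) = flipAt v j

    partner-b₁ : partner M (b (suc zero)) ≡ a (suc zero)
    partner-b₁ = trans (cong (flipAt (flipAt v j)) fj≡i) (flipAt-comm v j i)

    a₁≢v : a (suc zero) ≢ v
    a₁≢v = flipAt²≢ v (j≢i ∘ sym)

    cycle : AltCycle M 1
    cycle = record
      { a = a ; b = b
      ; a-inj = Fin2-injective a (a₁≢v ∘ sym)
      ; b-inj = Fin2-injective b (j≢i ∘ sym ∘ flipAt-injectiveʳ v)
      ; ab-dis = λ { zero zero eq → flipAt-irreflexive v i (sym eq)
                   ; zero (suc zero) eq → flipAt-irreflexive v j (sym eq)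
                   ; (suc zero) zero eq → flipAt≢flipAt² v i i j (sym eq)
                   ; (suc zero) (suc zero) eq → flipAt≢flipAt² v j i j (sym eq) }
      ; dimer = λ { zero → refl
                  ; (suc zero) → trans (sym (partner-involutive M (b (suc zero)))) (cong (partner M) partner-b₁) }
      ; edge = λ { zero → j , refl
                 ; (suc zero) → j , sym (flipAt-involutive v j) }
      ; nondim = λ { zero eq → a₁≢v (trans eq (partner-involutive M v))
                   ; (suc zero) eq → a₁≢v (sym (trans eq partner-b₁)) }
      }

    localCycle : 2 ≤ d → LocalCycle M d v
    localCycle 2≤d = record { n = 1 ; 1≤n = s≤s z≤n ; 1+n≤ℓ = 2≤d ; cycle = cycle }
      , near-onCycle cycle (λ { zero → inj₁ refl ; (suc zero) → inj₂ (inj₂ (i , j , refl)) })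
                           (λ { zero → inj₂ (inj₁ (i , refl)) ; (suc zero) → inj₂ (inj₁ (j , refl)) })

  -- the cycle v + e_{j_t} — v + e_{j_t} + e_{f j_t}, along a periodic orbit j_t of f
  module Orbit {x} (x≢i : x ≢ i) (avoids-i : ∀ {j} → j ≢ i → f j ≢ i) where
    orbit : ℕ → Fin (suc d)
    orbit zero = x
    orbit (suc k) = f (orbit k)

    orbit-≢ : ∀ k → orbit k ≢ i
    orbit-≢ zero = x≢i
    orbit-≢ (suc k) = avoids-i (orbit-≢ k)

    -- the orbit read in the d directions other than i, where pigeonhole applies
    orbit′ : ℕ → Fin d
    orbit′ k = punchOut (orbit-≢ k ∘ sym)

    module Periodic {p n} (p+n<d : suc (p + n) ≤ d) (period : orbit (suc (p + n)) ≡ orbit p)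
                    (distinct : ∀ {r s} → r < s → s ≤ p + n → orbit r ≢ orbit s) where

      orbit-injective : ∀ {r s} → r ≤ p + n → s ≤ p + n → orbit r ≡ orbit s → r ≡ s
      orbit-injective {r} {s} r≤ s≤ eq with ℕ.<-cmp r s
      ... | tri< r<s _ _ = contradiction eq (distinct r<s s≤)
      ... | tri≈ _ r≡s _ = r≡s
      ... | tri> _ _ s<r = contradiction (sym eq) (distinct s<r r≤)

      1≤n : 1 ≤ n
      1≤n = ℕ.n≢0⇒n>0 λ n≡0 → f-no-fixed-point (orbit-≢ p)
        (trans (cong (λ k → orbit (suc k)) (sym (trans (cong (p +_) n≡0) (ℕ.+-identityʳ p)))) period)

      j : Fin (suc n) → Fin (suc d)
      j t = orbit (p + toℕ t)

      j-injective : ∀ {s t} → j s ≡ j t → s ≡ t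
      j-injective eq = Fin.toℕ-injective (ℕ.+-cancelˡ-≡ p _ _ (orbit-injective (within _) (within _) eq))
        where
        within : ∀ t → p + toℕ t ≤ p + n
        within t = ℕ.+-monoʳ-≤ p (Fin.toℕ≤pred[n] t)

      j-next : ∀ t → j (sucMod t) ≡ f (j t)
      j-next t with <-or-last t
      ... | inj₁ t<n = trans (cong (λ k → orbit (p + k)) (toℕ-sucMod-< t t<n)) (cong orbit (ℕ.+-suc p (toℕ t)))
      ... | inj₂ t≡n = begin
        orbit (p + toℕ (sucMod t))  ≡⟨ cong (λ k → orbit (p + k)) (toℕ-sucMod-last t t≡n) ⟩
        orbit (p + 0)               ≡⟨ cong orbit (ℕ.+-identityʳ p) ⟩
        orbit p                     ≡⟨ period ⟨
        orbit (suc (p + n))         ≡⟨ cong (λ k → orbit (suc (p + k))) t≡n ⟨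
        f (j t)                     ∎
        where open ≡-Reasoning

      a b : Fin (suc n) → Vertex (suc d)
      a t = flipAt v (j t)
      b t = partner M (a t)

      a-injective : ∀ {s t} → a s ≡ a t → s ≡ t
      a-injective = j-injective ∘ flipAt-injectiveʳ v

      next-a : ∀ t → a (sucMod t) ≡ flipAt (b t) (j t)
      next-a t = begin
        flipAt v (j (sucMod t))
          ≡⟨ cong (flipAt v) (j-next t) ⟩
        flipAt v (f (j t))
          ≡⟨ cong (λ w → flipAt w (f (j t))) (flipAt-involutive v (j t)) ⟨
        flipAt (flipAt (flipAt v (j t)) (j t)) (f (j t))
          ≡⟨ flipAt-comm (flipAt v (j t)) (j t) (f (j t)) ⟩
        flipAt (b t) (j t)
          ∎
        where open ≡-Reasoning

      cycle : AltCycle M n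
      cycle = record
        { a = a ; b = b
        ; a-inj = λ s t s≢t → s≢t ∘ a-injective
        ; b-inj = λ s t s≢t → s≢t ∘ a-injective ∘ partner-injective M
        ; ab-dis = λ s t → flipAt≢flipAt² v (j s) (j t) (f (j t))
        ; dimer = λ t → refl
        ; edge = λ t → j t , next-a t
        ; nondim = λ t eq → sucMod-≢ 1≤n t (a-injective (trans eq (partner-involutive M (a t))))
        }

      localCycle : LocalCycle M d v
      localCycle =
          record { n = n ; 1≤n = 1≤n ; 1+n≤ℓ = ℕ.≤-trans (s≤s (ℕ.m≤n+m n p)) p+n<d ; cycle = cycle }
        , near-onCycle cycle (λ t → inj₂ (inj₁ (j t , refl))) (λ t → inj₂ (inj₂ (j t , f (j t) , refl)))

    localCycle : LocalCycle M d v
    localCycle with firstRepetition orbit′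
    ... | p , n , p+n<d , period′ , distinct′ = Periodic.localCycle {p} {n} p+n<d period distinct
      where
      period : orbit (suc (p + n)) ≡ orbit p
      period = Fin.punchOut-injective (orbit-≢ (suc (p + n)) ∘ sym) (orbit-≢ p ∘ sym) period′
      distinct : ∀ {r s} → r < s → s ≤ p + n → orbit r ≢ orbit s
      distinct r<s s≤ = distinct′ r<s s≤ ∘ Fin.punchOut-cong i

  localCycle : 2 ≤ d → LocalCycle M d v
  localCycle 2≤d with Fin.any? (λ j → ¬? (j Fin.≟ i) ×-dec (f j Fin.≟ i))
  ... | yes (j , j≢i , fj≡i) = Square.localCycle j≢i fj≡i 2≤d
  ... | no none = Orbit.localCycle (Fin.punchInᵢ≢i i (fromℕ< 2≤d)) (λ j≢i fj≡i → none (_ , j≢i , fj≡i))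

localCycle : ∀ {d} → 3 ≤ d → (M : Dimer d) (v : Vertex d) → LocalCycle M (d ∸ 1) v
localCycle {suc d} (s≤s 2≤d) M v = Local.localCycle M v 2≤d

-- Disjoint cycles switch independently

module _ {d ℓ : ℕ} {M : Dimer d} where
  open ShortCycle

  vertices : ShortCycle M ℓ → List (Vertex d)
  vertices c = tabulate a ++ tabulate b
    where open AltCycle (cycle c)

  length-vertices : ∀ c → length (vertices c) ≡ suc (n c) + suc (n c)
  length-vertices c = trans (length-++ (tabulate a)) (cong₂ _+_ (length-tabulate a) (length-tabulate b))
    where open AltCycle (cycle c)

  onCycle⇒∈vertices : ∀ c {v} → OnCycle (cycle c) v → v ∈ vertices c
  onCycle⇒∈vertices c (inj₁ (t , refl)) = ∈-++⁺ˡ (∈-tabulate⁺ {f = AltCycle.a (cycle c)} t)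
  onCycle⇒∈vertices c (inj₂ (t , refl)) =
    ∈-++⁺ʳ (tabulate (AltCycle.a (cycle c))) (∈-tabulate⁺ {f = AltCycle.b (cycle c)} t)

  ∈vertices⇒onCycle : ∀ c {v} → v ∈ vertices c → OnCycle (cycle c) v
  ∈vertices⇒onCycle c v∈ with ∈-++⁻ (tabulate (AltCycle.a (cycle c))) v∈
  ... | inj₁ v∈a = inj₁ (∈-tabulate⁻ v∈a)
  ... | inj₂ v∈b = inj₂ (∈-tabulate⁻ v∈b)

  record Meets (c c′ : ShortCycle M ℓ) : Set where
    constructor meet
    field
      common : Any (_∈ vertices c′) (vertices c)

  meets? : Decidable Meets
  meets? c c′ = map′ meet Meets.common (any? (_∈? vertices c′) (vertices c))
    where open import Data.List.Membership.DecPropositional (_≟ᵛ_ {d}) using (_∈?_)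

  meets-refl : ∀ {c} → Meets c c
  meets-refl {c} = meet (lose a₀∈ a₀∈)
    where a₀∈ = onCycle⇒∈vertices c (inj₁ (zero , refl))

  Disjoint : ShortCycle M ℓ → ShortCycle M ℓ → Set
  Disjoint c c′ = ¬ Meets c c′

  disjoint-sym : ∀ {c c′} → Disjoint c c′ → Disjoint c′ c
  disjoint-sym c#c′ (meet common) with find common
  ... | w , w∈c′ , w∈c = c#c′ (meet (lose w∈c w∈c′))

  disjoint-off : ∀ {c c′ v} → Disjoint c c′ → OnCycle (cycle c) v → ¬ OnCycle (cycle c′) v
  disjoint-off {c} {c′} c#c′ on on′ =
    c#c′ (meet (lose (onCycle⇒∈vertices c on) (onCycle⇒∈vertices c′ on′)))

  marker : ShortCycle M ℓ → Vertex d
  marker c = AltCycle.b (cycle c) zero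

  marker-onCycle : ∀ c → OnCycle (cycle c) (marker c)
  marker-onCycle c = inj₂ (zero , refl)

  switchShort : ShortCycle M ℓ → Dimer d
  switchShort c = Switching.switch (cycle c)

  switchShort-adjacent : ∀ c → DAdj ℓ M (switchShort c)
  switchShort-adjacent c = inj₁ (n c , 1≤n c , 1+n≤ℓ c , cycle c , Switching.switch-switchedBy (cycle c))

  transferShort : ∀ {N} (c : ShortCycle M ℓ) → AgreeOn (cycle c) N → ShortCycle N ℓ
  transferShort c agree =
    record { n = n c ; 1≤n = 1≤n c ; 1+n≤ℓ = 1+n≤ℓ c ; cycle = transferCycle (cycle c) agree }

module _ {d} (M : Dimer d) where

  agreesAt : Dimer d → Vertex d → Bool
  agreesAt N v = does (dir N v Fin.≟ dir M v)

  different-agreesAt : ∀ {N N′} v → agreesAt N v ≢ agreesAt N′ v → Different N N′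
  different-agreesAt v ≢ = v , ≢ ∘ cong (λ D → does (D Fin.≟ dir M v))

module _ {d ℓ : ℕ} (M : Dimer d) where
  open ShortCycle

  -- result is N with exactly the cycles lookup cs k for which keep k ≡ false switched
  record SwitchedFamily (cs : List (ShortCycle M ℓ)) (keep : Fin (length cs) → Bool) (N : Dimer d) : Set where
    field
      result    : Dimer d
      reachable : Connected ℓ N result
      markers   : ∀ k → agreesAt M result (marker (lookup cs k)) ≡ keep k
      elsewhere : ∀ v → All (λ c → ¬ OnCycle (cycle c) v) cs → dir result v ≡ dir N v

  keepOrSwitch : ∀ c keep N → AgreeOn (cycle c) N → SwitchedFamily (c ∷ []) (λ _ → keep) N
  keepOrSwitch c true N agree = record
    { result = N ; reachable = ε
    ; markers = λ { zero → dec-true (_ Fin.≟ _) (agree _ (marker-onCycle c)) }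
    ; elsewhere = λ _ _ → refl }
  keepOrSwitch c false N agree = record
    { result = switchShort c′ ; reachable = switchShort-adjacent c′ ◅ ε
    ; markers = λ { zero → dec-false (_ Fin.≟ _) λ eq →
        Switching.switch-changes (cycle c′) zero (trans eq (sym (agree _ (marker-onCycle c)))) }
    ; elsewhere = λ { v (off ∷ []) → Switching.switchedDir-off (cycle c′) off } }
    where
    c′ = transferShort c agree

  switchFamily : ∀ {cs} → AllPairs Disjoint cs → ∀ keep N → All (λ c → AgreeOn (cycle c) N) cs →
    SwitchedFamily cs keep N
  switchFamily [] keep N [] = record { result = N ; reachable = ε ; markers = λ () ; elsewhere = λ _ _ → refl }
  switchFamily {c ∷ cs} (c#cs ∷ disjoint) keep N (agree ∷ agrees) = record
    { result = result rest
    ; reachable = reachable first ◅◅ reachable rest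
    ; markers = λ { zero → trans (cong (λ D → does (D Fin.≟ dir M (marker c))) marker-kept) (markers first zero)
                  ; (suc k) → markers rest k }
    ; elsewhere = λ { v (off ∷ offs) → trans (elsewhere rest v offs) (elsewhere first v (off ∷ [])) }
    }
    where
    open SwitchedFamily
    first = keepOrSwitch c (keep zero) N agree
    agrees′ : All (λ c′ → AgreeOn (cycle c′) (result first)) cs
    agrees′ = All.zipWith (λ (c#c′ , agree′) v on′ →
      trans (elsewhere first v (disjoint-off (disjoint-sym c#c′) on′ ∷ [])) (agree′ v on′)) (c#cs , agrees)
    rest = switchFamily disjoint (keep ∘ suc) (result first) agrees′
    marker-kept : dir (result rest) (marker c) ≡ dir (result first) (marker c)
    marker-kept = elsewhere rest (marker c) (All.map (λ c#c′ → disjoint-off c#c′ (marker-onCycle c)) c#cs)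

-- A maximal family of disjoint local cycles

module Covering {d} (3≤d : 3 ≤ d) (M : Dimer d) where
  open ShortCycle
  open Greedy (meets? {ℓ = d ∸ 1} {M = M}) (λ {c} → meets-refl {c = c})

  candidates : List (ShortCycle M (d ∸ 1))
  candidates = map (proj₁ ∘ localCycle 3≤d M) (allVertices d)

  family : List (ShortCycle M (d ∸ 1))
  family = greedy candidates

  family-disjoint : AllPairs Disjoint family
  family-disjoint = greedy-independent candidates

  neighbourhood : List (Vertex d)
  neighbourhood = concatMap (concatMap ball₂ ∘ vertices) family

  ∈-neighbourhood : ∀ u → u ∈ neighbourhood
  ∈-neighbourhood u with find (greedy-maximal (∈-map⁺ (proj₁ ∘ localCycle 3≤d M) (∈-allVertices u)))
  ... | c , c∈family , meet common with find common
  ...   | w , w∈local , w∈c =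
    ∈-concat⁺′ (∈-concat⁺′ (near-∈-ball₂ u-near-w) (∈-map⁺ ball₂ w∈c)) (∈-map⁺ _ c∈family)
    where
    u-near-w : Near u w
    u-near-w = proj₂ (localCycle 3≤d M u) w (∈vertices⇒onCycle (proj₁ (localCycle 3≤d M u)) w∈local)

  length-neighbourhood : length neighbourhood ≤ length family * d ^ 4
  length-neighbourhood =
    ℕ.≤-trans (length-concatMap-≤ _ per-cycle family) (ℕ.*-monoʳ-≤ (length family) (2d[1+d+d²]≤d⁴ 3≤d))
    where
    per-cycle : ∀ c → length (concatMap ball₂ (vertices c)) ≤ (d + d) * ℕ.suc (d + d * d)
    per-cycle c = ℕ.≤-trans (length-concatMap-≤ ball₂ length-ball₂ (vertices c))
      (ℕ.*-monoˡ-≤ _ (ℕ.≤-trans (ℕ.≤-reflexive (length-vertices c)) (ℕ.+-mono-≤ short short)))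
      where
      short : ℕ.suc (n c) ≤ d
      short = ℕ.≤-trans (1+n≤ℓ c) (ℕ.m∸n≤m d 1)

  2^d≤|family|*d⁴ : 2 ^ d ≤ length family * d ^ 4
  2^d≤|family|*d⁴ = ℕ.≤-trans (2^d≤length ∈-neighbourhood) length-neighbourhood

  many-neighbours : ∃[ k ] (2 ^ d ≤ k * d ^ 4 ×
    Σ (Fin k → Dimer d) λ f → PairwiseDifferent f × (∀ i → DAdj (d ∸ 1) M (f i)))
  many-neighbours =
    length family , 2^d≤|family|*d⁴ , switchShort ∘ lookup family , pairwise , switchShort-adjacent ∘ lookup family
    where
    pairwise : PairwiseDifferent (switchShort ∘ lookup family)
    pairwise k k′ k≢k′ = different-agreesAt M {switchShort c} {switchShort c′} (marker c)
      λ eq → contradiction (trans (sym switched) (trans eq kept)) λ ()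
      where
      c = lookup family k
      c′ = lookup family k′
      switched : agreesAt M (switchShort c) (marker c) ≡ false
      switched = dec-false (_ Fin.≟ _) (Switching.switch-changes (cycle c) zero)
      kept : agreesAt M (switchShort c′) (marker c) ≡ true
      kept = dec-true (_ Fin.≟ _) (Switching.switchedDir-off (cycle c′)
        (disjoint-off (AllPairs-lookup disjoint-sym family-disjoint k k′ k≢k′) (marker-onCycle c)))

  large-component : ∃[ N ] (2 ^ (2 ^ d) ≤ N ^ (d ^ 4) ×
    Σ (Fin N → Dimer d) λ f → PairwiseDifferent f × (∀ i → Connected (d ∸ 1) M (f i)))
  large-component = 2 ^ K , bound , result ∘ switched , pairwise , reachable ∘ switched
    where
    open SwitchedFamily
    K = length family
    switched : (x : Fin (2 ^ K)) → SwitchedFamily M family (bits K x) M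
    switched x = switchFamily M family-disjoint (bits K x) M (All.tabulate λ _ _ _ → refl)
    bound : 2 ^ (2 ^ d) ≤ (2 ^ K) ^ (d ^ 4)
    bound = ℕ.≤-trans (ℕ.^-monoʳ-≤ 2 2^d≤|family|*d⁴) (ℕ.≤-reflexive (sym (ℕ.^-*-assoc 2 K (d ^ 4))))
    pairwise : PairwiseDifferent (result ∘ switched)
    pairwise x y x≢y with bits-distinguish {K} x≢y
    ... | k , bx≢by = different-agreesAt M {result (switched x)} {result (switched y)} (marker (lookup family k))
      λ eq → bx≢by (trans (sym (markers (switched x) k)) (trans eq (markers (switched y) k)))

theorem1p5 : ∀ (d : ℕ) → 3 ≤ d →
    -- minimum degree of D_{d-1}(Q^d) is ≥ 2^d / d^4
    (∀ (M : Dimer d) → ∃[ k ] (2 ^ d ≤ k * d ^ 4 ×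
        Σ (Fin k → Dimer d) λ f → PairwiseDifferent f × (∀ i → DAdj (d ∸ 1) M (f i))))
    ×
    -- each component has ≥ 2^(2^d / d^4) configurations, i.e. N^(d^4) ≥ 2^(2^d)
    (∀ (M : Dimer d) → ∃[ N ] (2 ^ (2 ^ d) ≤ N ^ (d ^ 4) ×
        Σ (Fin N → Dimer d) λ f → PairwiseDifferent f × (∀ i → Connected (d ∸ 1) M (f i))))
theorem1p5 d 3≤d = Covering.many-neighbours 3≤d , Covering.large-component 3≤d
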